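{- Let $m\ge 1$ and $n\ge 0$ be integers. Then $$\sum_{k=0}^{mn}(-1)^k\binom{n}{k}_m^2=\begin{cases}0, & \text{if } mn \text{ is odd},\\[0.5ex] \binom{n}{mn/2}_m, & \text{if } m \text{ is even},\\[0.5ex] \displaystyle\sum_{i=0}^n(-1)^i\binom{n}{i}\binom{2n}{mn/2-i}_{\frac{m-1}{2}}, & \text{if } m \text{ is odd and } n \text{ is even}.\end{cases}$$
   Context: For an integer $r\ge 0$ let $p_r(t)=1+t+\cdots+t^r$ (so $p_0=1$). For integers $N\ge 0$ and $j$, $\binom{N}{j}_r$ is the coefficient of $t^j$ in $p_r(t)^N$ for $j\ge0$ and $0$ for $j<0$; in particular $\binom{N}{j}_0=[j=0]$. $\binom{n}{i}$ is the ordinary binomial coefficient. -}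

module Defs where

open import Data.Nat using (ℕ; zero; suc; _+_; _*_)
open import Data.List using (List; []; _∷_; replicate; lookup)
open import Data.Integer using (ℤ; +_; -_) renaming (_+_ to _+ℤ_; _*_ to _*ℤ_)
open import Data.Nat.Combinatorics using (_C_)

-- Polynomials with natural-number coefficients, as coefficient lists
-- (lowest degree first).
Poly : Set
Poly = List ℕ

_⊕_ : Poly → Poly → Poly
[] ⊕ q = q
(a ∷ p) ⊕ [] = a ∷ p
(a ∷ p) ⊕ (b ∷ q) = (a + b) ∷ (p ⊕ q)

scale : ℕ → Poly → Poly
scale c [] = []
scale c (a ∷ p) = (c * a) ∷ scale c p

_⊗_ : Poly → Poly → Poly
[] ⊗ q = []
(a ∷ p) ⊗ q = scale a q ⊕ (0 ∷ (p ⊗ q))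

pr : ℕ → Poly
pr r = replicate (suc r) 1

_^P_ : Poly → ℕ → Poly
p ^P zero = 1 ∷ []
p ^P suc N = p ⊗ (p ^P N)

coeff : Poly → ℕ → ℕ
coeff [] j = 0
coeff (a ∷ p) zero = a
coeff (a ∷ p) (suc j) = coeff p j

binomP : ℕ → ℕ → ℕ → ℕ
binomP r N j = coeff (pr r ^P N) j

binomPℤ : ℕ → ℕ → ℤ → ℕ
binomPℤ r N (+ j) = binomP r N j
binomPℤ r N _ = 0

sgn : ℕ → ℤ
sgn zero = + 1
sgn (suc k) = - sgn k

sumTo : ℕ → (ℕ → ℤ) → ℤ
sumTo zero f = f 0
sumTo (suc n) f = sumTo n f +ℤ f (suc n)

-- Since p_r is palindromic,
-- binomP m n k = binomP m n (mn − k), so the sum is the coefficient of t^(mn)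
-- in (p_m(−t) p_m(t))^n. For m = 2s one has p_m(t) = p_s(t²) + t p_(s−1)(t²)
-- and p_s² − t p_(s−1)² = p_m, whence p_m(−t) p_m(t) = p_m(t²); for m = 2s+1
-- one has p_m(t) = (1+t) p_s(t²), whence p_m(−t) p_m(t) = (1 − t²) p_s(t²)².
-- Either way the n-th power is a series in t², whose coefficient of t^(mn)
-- vanishes for odd mn and is otherwise read off at t^(mn/2); expanding
-- (1 − t)^n binomially gives the third formula.
module Submission where

open import Defs
open import Data.Nat using (ℕ; _*_; _∸_; _%_; _/_; _≥_)
open import Data.Nat.Combinatorics using (_C_)
open import Data.Integer using (ℤ; +_) renaming (_*_ to _*ℤ_; _-_ to _-ℤ_)
open import Data.Product using (_×_)
open import Relation.Binary.PropositionalEquality using (_≡_)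

open import Algebra.Bundles using (CommutativeRing)
open import Algebra.Solver.Ring.AlmostCommutativeRing
  using (fromCommutativeRing; _-Raw-AlmostCommutative⟶_)
open import Data.Empty using (⊥-elim)
open import Data.Integer using (0ℤ; 1ℤ; -_; +-*-rawRing) renaming (_+_ to _+ℤ_)
import Data.Integer.Properties as ℤ
open import Data.Integer.Tactic.RingSolver using (solve-∀)
open import Data.List using ([]; _∷_)
open import Data.Maybe using (Maybe; just; nothing)
open import Data.Nat using (zero; suc; _+_; _≤_; _<_; z≤n; s≤s; _≤?_)
open import Data.Nat.Combinatorics using (k>n⇒nCk≡0; nCk+nC[k+1]≡[n+1]C[k+1])
open import Data.Nat.DivMod using (m*n%n≡0; [m+kn]%n≡m%n; m*n/n≡m; %-distribˡ-*)
import Data.Nat.Properties as ℕ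
open import Data.Product using (_,_)
open import Function using (_∘_)
open import Level using (0ℓ)
open import Relation.Binary.PropositionalEquality
  using (refl; sym; trans; cong; cong₂; subst; module ≡-Reasoning)
open import Relation.Nullary using (yes; no)
import Relation.Binary.Reasoning.Setoid as SetoidReasoning

-- Formal power series over ℤ

Series : Set
Series = ℕ → ℤ

infix 4 _≈_
record _≈_ (f g : Series) : Set where
  constructor pointwise
  field at : ∀ k → f k ≡ g k
open _≈_ public

≈-refl : ∀ {f} → f ≈ f
≈-refl = pointwise λ _ → refl

≈-sym : ∀ {f g} → f ≈ g → g ≈ f
≈-sym (pointwise e) = pointwise λ k → sym (e k)

≈-trans : ∀ {f g h} → f ≈ g → g ≈ h → f ≈ h
≈-trans (pointwise e) (pointwise e′) = pointwise λ k → trans (e k) (e′ k)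

0ˢ : Series
0ˢ _ = 0ℤ

const : ℤ → Series
const c zero = c
const c (suc k) = 0ℤ

1ˢ : Series
1ˢ = const 1ℤ

tail : Series → Series
tail f k = f (suc k)

infixl 6 _⊞_
infixl 7 _⊠_ _·_
infix 8 ⊟_

_⊞_ : Series → Series → Series
(f ⊞ g) k = f k +ℤ g k

⊟_ : Series → Series
(⊟ f) k = - f k

_·_ : ℤ → Series → Series
(c · f) k = c *ℤ f k

_⊠_ : Series → Series → Series
(f ⊠ g) zero = f 0 *ℤ g 0
(f ⊠ g) (suc n) = f 0 *ℤ g (suc n) +ℤ (tail f ⊠ g) n

⊠-congˡ-at : ∀ {f f′} g → (∀ k → f k ≡ f′ k) → ∀ n → (f ⊠ g) n ≡ (f′ ⊠ g) n
⊠-congˡ-at g e zero = cong (_*ℤ g 0) (e 0)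
⊠-congˡ-at g e (suc n) = cong₂ _+ℤ_ (cong (_*ℤ g (suc n)) (e 0)) (⊠-congˡ-at g (λ k → e (suc k)) n)

⊠-congʳ-at : ∀ f {g g′} → (∀ k → g k ≡ g′ k) → ∀ n → (f ⊠ g) n ≡ (f ⊠ g′) n
⊠-congʳ-at f e zero = cong (f 0 *ℤ_) (e 0)
⊠-congʳ-at f e (suc n) = cong₂ _+ℤ_ (cong (f 0 *ℤ_) (e (suc n))) (⊠-congʳ-at (tail f) e n)

⊠-zeroˡ : ∀ g n → (0ˢ ⊠ g) n ≡ 0ℤ
⊠-zeroˡ g zero = refl
⊠-zeroˡ g (suc n) = cong₂ _+ℤ_ (ℤ.*-zeroˡ (g (suc n))) (⊠-zeroˡ g n)

·-⊠ : ∀ c f g n → (c · f ⊠ g) n ≡ c *ℤ (f ⊠ g) n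
·-⊠ c f g zero = ℤ.*-assoc c (f 0) (g 0)
·-⊠ c f g (suc n) =
  trans (cong₂ _+ℤ_ (ℤ.*-assoc c (f 0) (g (suc n))) (·-⊠ c (tail f) g n))
        (sym (ℤ.*-distribˡ-+ c (f 0 *ℤ g (suc n)) ((tail f ⊠ g) n)))

⊞-⊠ : ∀ f h g n → ((f ⊞ h) ⊠ g) n ≡ (f ⊠ g) n +ℤ (h ⊠ g) n
⊞-⊠ f h g zero = ℤ.*-distribʳ-+ (g 0) (f 0) (h 0)
⊞-⊠ f h g (suc n) =
  trans (cong₂ _+ℤ_ (ℤ.*-distribʳ-+ (g (suc n)) (f 0) (h 0)) (⊞-⊠ (tail f) (tail h) g n))
        (interchange (f 0 *ℤ g (suc n)) (h 0 *ℤ g (suc n)) ((tail f ⊠ g) n) ((tail h ⊠ g) n))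
  where
  interchange : ∀ a b c d → (a +ℤ b) +ℤ (c +ℤ d) ≡ (a +ℤ c) +ℤ (b +ℤ d)
  interchange = solve-∀

1ˢ-⊠ : ∀ g n → (1ˢ ⊠ g) n ≡ g n
1ˢ-⊠ g zero = ℤ.*-identityˡ (g 0)
1ˢ-⊠ g (suc n) =
  trans (cong₂ _+ℤ_ (ℤ.*-identityˡ (g (suc n))) (⊠-zeroˡ g n)) (ℤ.+-identityʳ (g (suc n)))

⊠-comm : ∀ f g n → (f ⊠ g) n ≡ (g ⊠ f) n
⊠-comm f g zero = ℤ.*-comm (f 0) (g 0)
⊠-comm f g (suc zero) = swap (f 0) (g 1) (f 1) (g 0)
  where
  swap : ∀ a b c d → a *ℤ b +ℤ c *ℤ d ≡ d *ℤ c +ℤ b *ℤ a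
  swap = solve-∀
⊠-comm f g (suc (suc n)) =
  trans (cong (f 0 *ℤ g (2 + n) +ℤ_) (⊠-comm (tail f) g (suc n)))
  (trans (cong (λ z → f 0 *ℤ g (2 + n) +ℤ (g 0 *ℤ f (2 + n) +ℤ z)) (⊠-comm (tail g) (tail f) n))
  (trans (exchange (f 0 *ℤ g (2 + n)) (g 0 *ℤ f (2 + n)) ((tail f ⊠ tail g) n))
         (sym (cong (g 0 *ℤ f (2 + n) +ℤ_) (⊠-comm (tail g) f (suc n))))))
  where
  exchange : ∀ a b c → a +ℤ (b +ℤ c) ≡ b +ℤ (a +ℤ c)
  exchange = solve-∀

⊠-assoc : ∀ f g h n → ((f ⊠ g) ⊠ h) n ≡ (f ⊠ (g ⊠ h)) n
⊠-assoc f g h zero = ℤ.*-assoc (f 0) (g 0) (h 0)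
⊠-assoc f g h (suc n) =
  trans (cong (f 0 *ℤ g 0 *ℤ h (suc n) +ℤ_)
          (trans (⊞-⊠ (f 0 · tail g) (tail f ⊠ g) h n)
                 (cong₂ _+ℤ_ (·-⊠ (f 0) (tail g) h n) (⊠-assoc (tail f) g h n))))
        (regroup (f 0) (g 0) (h (suc n)) ((tail g ⊠ h) n) ((tail f ⊠ (g ⊠ h)) n))
  where
  regroup : ∀ a b c d e → a *ℤ b *ℤ c +ℤ (a *ℤ d +ℤ e) ≡ a *ℤ (b *ℤ c +ℤ d) +ℤ e
  regroup = solve-∀

seriesRing : CommutativeRing 0ℓ 0ℓ
seriesRing = record
  { Carrier = Series ; _≈_ = _≈_ ; _+_ = _⊞_ ; _*_ = _⊠_ ; -_ = ⊟_ ; 0# = 0ˢ ; 1# = 1ˢ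
  ; isCommutativeRing = record
    { isRing = record
      { +-isAbelianGroup = record
        { isGroup = record
          { isMonoid = record
            { isSemigroup = record
              { isMagma = record
                { isEquivalence = record { refl = ≈-refl ; sym = ≈-sym ; trans = ≈-trans }
                ; ∙-cong = λ (pointwise e) (pointwise e′) → pointwise λ k → cong₂ _+ℤ_ (e k) (e′ k) }
              ; assoc = λ f g h → pointwise λ k → ℤ.+-assoc (f k) (g k) (h k) }
            ; identity = (λ f → pointwise λ k → ℤ.+-identityˡ (f k))
                       , (λ f → pointwise λ k → ℤ.+-identityʳ (f k)) }
          ; inverse = (λ f → pointwise λ k → ℤ.+-inverseˡ (f k))
                    , (λ f → pointwise λ k → ℤ.+-inverseʳ (f k))
          ; ⁻¹-cong = λ (pointwise e) → pointwise λ k → cong -_ (e k) }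
        ; comm = λ f g → pointwise λ k → ℤ.+-comm (f k) (g k) }
      ; *-cong = λ {_} {f′} {g} (pointwise e) (pointwise e′) →
                   pointwise λ n → trans (⊠-congˡ-at g e n) (⊠-congʳ-at f′ e′ n)
      ; *-assoc = λ f g h → pointwise (⊠-assoc f g h)
      ; *-identity = (λ g → pointwise (1ˢ-⊠ g))
                   , (λ g → pointwise λ n → trans (⊠-comm g 1ˢ n) (1ˢ-⊠ g n))
      ; distrib = (λ g f h → pointwise λ n →
                     trans (⊠-comm g (f ⊞ h) n)
                           (trans (⊞-⊠ f h g n) (cong₂ _+ℤ_ (⊠-comm f g n) (⊠-comm h g n))))
                , (λ g f h → pointwise (⊞-⊠ f h g))
      }
    ; *-comm = λ f g → pointwise (⊠-comm f g)
    }
  }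

open CommutativeRing seriesRing
  using (*-cong; +-cong; -‿cong; *-assoc; *-identityˡ; *-identityʳ; ring; commutativeSemiring)
  renaming (setoid to seriesSetoid)
open import Algebra.Properties.CommutativeSemiring.Exp commutativeSemiring
  using (_^_; ^-congˡ; ^-distrib-*; ^-assocʳ)
open import Algebra.Properties.Ring ring using (-‿distribˡ-*)
module ≈-Reasoning = SetoidReasoning seriesSetoid

-- Congruences with the fixed operand explicit: the series operations are not
-- injective, so Agda cannot infer it from the goal.
⊞-congˡ : ∀ f {g g′} → g ≈ g′ → f ⊞ g ≈ f ⊞ g′
⊞-congˡ f = +-cong (≈-refl {f})

⊞-congʳ : ∀ g {f f′} → f ≈ f′ → f ⊞ g ≈ f′ ⊞ g
⊞-congʳ g f≈f′ = +-cong f≈f′ (≈-refl {g})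

⊠-congˡ : ∀ f {g g′} → g ≈ g′ → f ⊠ g ≈ f ⊠ g′
⊠-congˡ f = *-cong (≈-refl {f})

⊠-congʳ : ∀ g {f f′} → f ≈ f′ → f ⊠ g ≈ f′ ⊠ g
⊠-congʳ g f≈f′ = *-cong f≈f′ (≈-refl {g})

const-⊠ : ∀ c g → const c ⊠ g ≈ c · g
const-⊠ c g = pointwise λ where
  zero → refl
  (suc n) → trans (cong (c *ℤ g (suc n) +ℤ_) (⊠-zeroˡ g n)) (ℤ.+-identityʳ _)

-- The ring solver works with integer constants embedded by const, since
-- series have no decidable zero test.
const-homomorphism : +-*-rawRing -Raw-AlmostCommutative⟶ fromCommutativeRing seriesRing
const-homomorphism = record
  { ⟦_⟧ = const
  ; +-homo = λ _ _ → pointwise λ { zero → refl ; (suc _) → refl }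
  ; *-homo = λ a b → pointwise λ where
      zero → refl
      (suc k) → sym (trans (at (const-⊠ a (const b)) (suc k)) (ℤ.*-zeroʳ a))
  ; -‿homo = λ _ → pointwise λ { zero → refl ; (suc _) → refl }
  ; 0-homo = pointwise λ { zero → refl ; (suc _) → refl }
  ; 1-homo = ≈-refl
  }

const-≟ : ∀ a b → Maybe (const a ≈ const b)
const-≟ a b with a ℤ.≟ b
... | yes refl = just ≈-refl
... | no _ = nothing

open import Algebra.Solver.Ring +-*-rawRing (fromCommutativeRing seriesRing) const-homomorphism const-≟
  using (solve; _:=_; _:+_; _:*_; _:-_; :-_; con)

-- The variable, substitutions t ↦ −t and t ↦ t²

X : Series
X zero = 0ℤ
X (suc k) = 1ˢ k

X⊠-zero : ∀ h → (X ⊠ h) 0 ≡ 0ℤ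
X⊠-zero h = ℤ.*-zeroˡ (h 0)

X⊠-suc : ∀ h n → (X ⊠ h) (suc n) ≡ h n
X⊠-suc h n = trans (cong₂ _+ℤ_ (ℤ.*-zeroˡ (h (suc n))) (1ˢ-⊠ h n)) (ℤ.+-identityˡ (h n))

head-tail : ∀ f → f ≈ const (f 0) ⊞ X ⊠ tail f
head-tail f = pointwise λ where
  zero → sym (trans (cong (f 0 +ℤ_) (X⊠-zero (tail f))) (ℤ.+-identityʳ (f 0)))
  (suc k) → sym (trans (ℤ.+-identityˡ _) (X⊠-suc (tail f) k))

module _ {φ : Series → Series}
         (φ-⊠ : ∀ f g → φ (f ⊠ g) ≈ φ f ⊠ φ g) (φ-1ˢ : φ 1ˢ ≈ 1ˢ) where

  ^-homomorphic : ∀ f N → φ (f ^ N) ≈ φ f ^ N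
  ^-homomorphic f zero = φ-1ˢ
  ^-homomorphic f (suc N) = ≈-trans (φ-⊠ f (f ^ N)) (⊠-congˡ (φ f) (^-homomorphic f N))

twist : Series → Series
twist f k = sgn k *ℤ f k

twist-cong : ∀ {f g} → f ≈ g → twist f ≈ twist g
twist-cong (pointwise e) = pointwise λ k → cong (sgn k *ℤ_) (e k)

twist-⊞ : ∀ f g → twist (f ⊞ g) ≈ twist f ⊞ twist g
twist-⊞ f g = pointwise λ k → ℤ.*-distribˡ-+ (sgn k) (f k) (g k)

twist-⊠-at : ∀ f g n → twist (f ⊠ g) n ≡ (twist f ⊠ twist g) n
twist-⊠-at f g zero =
  trans (ℤ.*-identityˡ _) (sym (cong₂ _*ℤ_ (ℤ.*-identityˡ (f 0)) (ℤ.*-identityˡ (g 0))))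
twist-⊠-at f g (suc n) = begin
  - sgn n *ℤ (f 0 *ℤ g (suc n) +ℤ (tail f ⊠ g) n)
    ≡⟨ shuffle (sgn n) (f 0) (g (suc n)) ((tail f ⊠ g) n) ⟩
  f 0 *ℤ (- sgn n *ℤ g (suc n)) +ℤ - (sgn n *ℤ (tail f ⊠ g) n)
    ≡⟨ cong₂ _+ℤ_ (cong (_*ℤ _) (sym (ℤ.*-identityˡ (f 0)))) (cong -_ (twist-⊠-at (tail f) g n)) ⟩
  twist f 0 *ℤ twist g (suc n) +ℤ - (twist (tail f) ⊠ twist g) n
    ≡⟨ cong (twist f 0 *ℤ twist g (suc n) +ℤ_) (at (-‿distribˡ-* (twist (tail f)) (twist g)) n) ⟩
  twist f 0 *ℤ twist g (suc n) +ℤ (⊟ twist (tail f) ⊠ twist g) n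
    ≡⟨ cong (twist f 0 *ℤ twist g (suc n) +ℤ_)
            (⊠-congˡ-at (twist g) (λ k → ℤ.neg-distribˡ-* (sgn k) (f (suc k))) n) ⟩
  twist f 0 *ℤ twist g (suc n) +ℤ (tail (twist f) ⊠ twist g) n ∎
  where
  open ≡-Reasoning
  shuffle : ∀ s a b c → - s *ℤ (a *ℤ b +ℤ c) ≡ a *ℤ (- s *ℤ b) +ℤ - (s *ℤ c)
  shuffle = solve-∀

twist-⊠ : ∀ f g → twist (f ⊠ g) ≈ twist f ⊠ twist g
twist-⊠ f g = pointwise (twist-⊠-at f g)

twist-1ˢ : twist 1ˢ ≈ 1ˢ
twist-1ˢ = pointwise λ { zero → refl ; (suc k) → ℤ.*-zeroʳ (sgn (suc k)) }

twist-X : twist X ≈ ⊟ X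
twist-X = pointwise λ where
  zero → refl
  (suc zero) → refl
  (suc (suc k)) → ℤ.*-zeroʳ (sgn (2 + k))

twist-^ : ∀ f N → twist (f ^ N) ≈ twist f ^ N
twist-^ = ^-homomorphic twist-⊠ twist-1ˢ

-- dilate f is f(t²)
dilate : Series → Series
dilate f zero = f 0
dilate f (suc zero) = 0ℤ
dilate f (suc (suc k)) = dilate (tail f) k

dilate-cong : ∀ {f g} → f ≈ g → dilate f ≈ dilate g
dilate-cong e = pointwise (go e)
  where
  go : ∀ {f g} → f ≈ g → ∀ k → dilate f k ≡ dilate g k
  go e zero = at e 0
  go e (suc zero) = refl
  go e (suc (suc k)) = go (pointwise λ j → at e (suc j)) k

dilate-⊞-at : ∀ f g k → dilate (f ⊞ g) k ≡ dilate f k +ℤ dilate g k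
dilate-⊞-at f g zero = refl
dilate-⊞-at f g (suc zero) = refl
dilate-⊞-at f g (suc (suc k)) = dilate-⊞-at (tail f) (tail g) k

dilate-⊞ : ∀ f g → dilate (f ⊞ g) ≈ dilate f ⊞ dilate g
dilate-⊞ f g = pointwise (dilate-⊞-at f g)

dilate-⊟ : ∀ f → dilate (⊟ f) ≈ ⊟ dilate f
dilate-⊟ f = pointwise (go f)
  where
  go : ∀ f k → dilate (⊟ f) k ≡ - dilate f k
  go f zero = refl
  go f (suc zero) = refl
  go f (suc (suc k)) = go (tail f) k

dilate-· : ∀ c f k → dilate (c · f) k ≡ c *ℤ dilate f k
dilate-· c f zero = refl
dilate-· c f (suc zero) = sym (ℤ.*-zeroʳ c)
dilate-· c f (suc (suc k)) = dilate-· c (tail f) k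

dilate-⊠-at : ∀ f g k → dilate (f ⊠ g) k ≡ (dilate f ⊠ dilate g) k
dilate-⊠-at f g zero = refl
dilate-⊠-at f g (suc zero) = sym (cong₂ _+ℤ_ (ℤ.*-zeroʳ (f 0)) (ℤ.*-zeroˡ (g 0)))
dilate-⊠-at f g (suc (suc k)) = begin
  dilate (f 0 · tail g ⊞ tail f ⊠ g) k
    ≡⟨ dilate-⊞-at (f 0 · tail g) (tail f ⊠ g) k ⟩
  dilate (f 0 · tail g) k +ℤ dilate (tail f ⊠ g) k
    ≡⟨ cong₂ _+ℤ_ (dilate-· (f 0) (tail g) k) (dilate-⊠-at (tail f) g k) ⟩
  f 0 *ℤ dilate g (2 + k) +ℤ (dilate (tail f) ⊠ dilate g) k
    ≡⟨ cong (f 0 *ℤ dilate g (2 + k) +ℤ_) (sym (tail-dilate-⊠ (dilate g))) ⟩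
  f 0 *ℤ dilate g (2 + k) +ℤ (tail (dilate f) ⊠ dilate g) (suc k) ∎
  where
  open ≡-Reasoning
  tail-dilate-⊠ : ∀ h → (tail (dilate f) ⊠ h) (suc k) ≡ (dilate (tail f) ⊠ h) k
  tail-dilate-⊠ h =
    trans (cong (_+ℤ (dilate (tail f) ⊠ h) k) (ℤ.*-zeroˡ (h (suc k)))) (ℤ.+-identityˡ _)

dilate-⊠ : ∀ f g → dilate (f ⊠ g) ≈ dilate f ⊠ dilate g
dilate-⊠ f g = pointwise (dilate-⊠-at f g)

dilate-1ˢ : dilate 1ˢ ≈ 1ˢ
dilate-1ˢ = pointwise go
  where
  go : ∀ k → dilate 1ˢ k ≡ 1ˢ k
  go zero = refl
  go (suc zero) = refl
  go (suc (suc k)) = dilate-0ˢ k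
    where
    dilate-0ˢ : ∀ k → dilate 0ˢ k ≡ 0ℤ
    dilate-0ˢ zero = refl
    dilate-0ˢ (suc zero) = refl
    dilate-0ˢ (suc (suc k)) = dilate-0ˢ k

dilate-X : dilate X ≈ X ⊠ X
dilate-X = pointwise λ where
  zero → sym (X⊠-zero X)
  (suc zero) → sym (X⊠-suc X 0)
  (suc (suc k)) → trans (at dilate-1ˢ k) (sym (X⊠-suc X (suc k)))

dilate-^ : ∀ f N → dilate (f ^ N) ≈ dilate f ^ N
dilate-^ = ^-homomorphic dilate-⊠ dilate-1ˢ

twist-dilate : ∀ f → twist (dilate f) ≈ dilate f
twist-dilate f = pointwise (go f)
  where
  go : ∀ f k → twist (dilate f) k ≡ dilate f k
  go f zero = ℤ.*-identityˡ (f 0)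
  go f (suc zero) = refl
  go f (suc (suc k)) = trans (cong (_*ℤ dilate (tail f) k) (ℤ.neg-involutive (sgn k))) (go (tail f) k)

-- Degree and reversal

Deg≤ : ℕ → Series → Set
Deg≤ D f = ∀ k → D < k → f k ≡ 0ℤ

Deg≤-const : ∀ c → Deg≤ 0 (const c)
Deg≤-const c (suc k) _ = refl

Deg≤-zero : ∀ {f} → Deg≤ 0 f → f ≈ const (f 0)
Deg≤-zero df = pointwise λ { zero → refl ; (suc k) → df (suc k) (s≤s z≤n) }

Deg≤-⊠ : ∀ {f g} D E → Deg≤ D f → Deg≤ E g → Deg≤ (D + E) (f ⊠ g)
Deg≤-⊠ {f} {g} zero E df dg (suc n) E<1+n =
  cong₂ _+ℤ_ (trans (cong (f 0 *ℤ_) (dg (suc n) E<1+n)) (ℤ.*-zeroʳ (f 0)))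
             (trans (⊠-congˡ-at {f′ = 0ˢ} g (λ k → df (suc k) (s≤s z≤n)) n) (⊠-zeroˡ g n))
Deg≤-⊠ {f} {g} (suc D) E df dg (suc n) (s≤s D+E<n) =
  cong₂ _+ℤ_ (trans (cong (f 0 *ℤ_) (dg (suc n) (ℕ.≤-<-trans (ℕ.m≤n+m E (suc D)) (s≤s D+E<n))))
                    (ℤ.*-zeroʳ (f 0)))
             (Deg≤-⊠ D E (λ k D<k → df (suc k) (s≤s D<k)) dg n D+E<n)

Deg≤-^ : ∀ {f} r N → Deg≤ r f → Deg≤ (N * r) (f ^ N)
Deg≤-^ r zero df = Deg≤-const 1ℤ
Deg≤-^ r (suc N) df = Deg≤-⊠ r (N * r) df (Deg≤-^ r N df)

-- reverse D f is t^D f(1/t), the reversal of a series of degree at most D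
reverse : ℕ → Series → Series
reverse zero f zero = f 0
reverse zero f (suc k) = 0ℤ
reverse (suc D) f zero = f (suc D)
reverse (suc D) f (suc k) = reverse D f k

reverse-cong : ∀ D {f g} → f ≈ g → reverse D f ≈ reverse D g
reverse-cong D e = pointwise (go D e)
  where
  go : ∀ D {f g} → f ≈ g → ∀ k → reverse D f k ≡ reverse D g k
  go zero e zero = at e 0
  go zero e (suc k) = refl
  go (suc D) e zero = at e (suc D)
  go (suc D) e (suc k) = go D e k

reverse-⊞ : ∀ D f g → reverse D (f ⊞ g) ≈ reverse D f ⊞ reverse D g
reverse-⊞ D f g = pointwise (go D)
  where
  go : ∀ D k → reverse D (f ⊞ g) k ≡ reverse D f k +ℤ reverse D g k
  go zero zero = refl
  go zero (suc k) = refl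
  go (suc D) zero = refl
  go (suc D) (suc k) = go D k

reverse-· : ∀ D c f → reverse D (c · f) ≈ c · reverse D f
reverse-· D c f = pointwise (go D)
  where
  go : ∀ D k → reverse D (c · f) k ≡ c *ℤ reverse D f k
  go zero zero = refl
  go zero (suc k) = sym (ℤ.*-zeroʳ c)
  go (suc D) zero = refl
  go (suc D) (suc k) = go D k

reverse-≤ : ∀ D f k → k ≤ D → reverse D f k ≡ f (D ∸ k)
reverse-≤ zero f zero _ = refl
reverse-≤ (suc D) f zero _ = refl
reverse-≤ (suc D) f (suc k) (s≤s k≤D) = reverse-≤ D f k k≤D

reverse-> : ∀ D f k → D < k → reverse D f k ≡ 0ℤ
reverse-> zero f (suc k) _ = refl
reverse-> (suc D) f (suc k) (s≤s D<k) = reverse-> D f k D<k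

reverse-zero : ∀ f → reverse 0 f ≈ const (f 0)
reverse-zero f = pointwise λ { zero → refl ; (suc k) → refl }

reverse-X⊠ : ∀ D h → reverse (suc D) (X ⊠ h) ≈ reverse D h
reverse-X⊠ D h = pointwise (go D)
  where
  go : ∀ D k → reverse (suc D) (X ⊠ h) k ≡ reverse D h k
  go zero zero = X⊠-suc h 0
  go zero (suc zero) = X⊠-zero h
  go zero (suc (suc k)) = refl
  go (suc D) zero = X⊠-suc h (suc D)
  go (suc D) (suc k) = go D k

reverse-pad : ∀ {g} E j → Deg≤ E g → reverse (j + E) g ≈ X ^ j ⊠ reverse E g
reverse-pad {g} E zero dg = ≈-sym (*-identityˡ (reverse E g))
reverse-pad {g} E (suc j) dg =
  ≈-trans (pointwise shifted) (≈-sym (*-assoc X (X ^ j) (reverse E g)))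
  where
  shifted : ∀ k → reverse (suc j + E) g k ≡ (X ⊠ (X ^ j ⊠ reverse E g)) k
  shifted zero = trans (dg (suc (j + E)) (s≤s (ℕ.m≤n+m E j))) (sym (X⊠-zero (X ^ j ⊠ reverse E g)))
  shifted (suc k) = trans (at (reverse-pad E j dg) k) (sym (X⊠-suc (X ^ j ⊠ reverse E g) k))

reverse-const : ∀ D c → reverse D (const c) ≈ X ^ D ⊠ const c
reverse-const D c =
  subst (λ E → reverse E (const c) ≈ X ^ D ⊠ const c) (ℕ.+-identityʳ D)
        (≈-trans (reverse-pad 0 D (Deg≤-const c)) (⊠-congˡ (X ^ D) (reverse-zero (const c))))

reverse-suc : ∀ D f → reverse (suc D) f ≈ X ^ suc D ⊠ const (f 0) ⊞ reverse D (tail f)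
reverse-suc D f = begin
  reverse (suc D) f                                     ≈⟨ reverse-cong (suc D) (head-tail f) ⟩
  reverse (suc D) (const (f 0) ⊞ X ⊠ tail f)            ≈⟨ reverse-⊞ (suc D) (const (f 0)) (X ⊠ tail f) ⟩
  reverse (suc D) (const (f 0)) ⊞ reverse (suc D) (X ⊠ tail f)
    ≈⟨ +-cong (reverse-const (suc D) (f 0)) (reverse-X⊠ D (tail f)) ⟩
  X ^ suc D ⊠ const (f 0) ⊞ reverse D (tail f)          ∎
  where open ≈-Reasoning

reverse-const-⊠ : ∀ E c g → reverse E (const c ⊠ g) ≈ const c ⊠ reverse E g
reverse-const-⊠ E c g = begin
  reverse E (const c ⊠ g) ≈⟨ reverse-cong E (const-⊠ c g) ⟩
  reverse E (c · g)       ≈⟨ reverse-· E c g ⟩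
  c · reverse E g         ≈⟨ ≈-sym (const-⊠ c (reverse E g)) ⟩
  const c ⊠ reverse E g   ∎
  where open ≈-Reasoning

⊠-head-tail : ∀ f g → f ⊠ g ≈ const (f 0) ⊠ g ⊞ X ⊠ (tail f ⊠ g)
⊠-head-tail f g =
  ≈-trans (⊠-congʳ g (head-tail f))
          (solve 4 (λ c x t g → (c :+ x :* t) :* g := c :* g :+ x :* (t :* g)) ≈-refl
                 (const (f 0)) X (tail f) g)

reverse-⊠ : ∀ {f g} D E → Deg≤ D f → Deg≤ E g → reverse (D + E) (f ⊠ g) ≈ reverse D f ⊠ reverse E g
reverse-⊠ {f} {g} zero E df dg = begin
  reverse E (f ⊠ g)             ≈⟨ reverse-cong E (⊠-congʳ g (Deg≤-zero df)) ⟩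
  reverse E (const (f 0) ⊠ g)   ≈⟨ reverse-const-⊠ E (f 0) g ⟩
  const (f 0) ⊠ reverse E g     ≈⟨ ⊠-congʳ (reverse E g) (≈-sym (reverse-zero f)) ⟩
  reverse 0 f ⊠ reverse E g     ∎
  where open ≈-Reasoning
reverse-⊠ {f} {g} (suc D) E df dg = begin
  reverse (suc D + E) (f ⊠ g)
    ≈⟨ reverse-cong (suc D + E) (⊠-head-tail f g) ⟩
  reverse (suc D + E) (c ⊠ g ⊞ X ⊠ (tail f ⊠ g))
    ≈⟨ reverse-⊞ (suc D + E) (c ⊠ g) (X ⊠ (tail f ⊠ g)) ⟩
  reverse (suc D + E) (c ⊠ g) ⊞ reverse (suc D + E) (X ⊠ (tail f ⊠ g))
    ≈⟨ ⊞-congˡ (reverse (suc D + E) (c ⊠ g)) (reverse-X⊠ (D + E) (tail f ⊠ g)) ⟩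
  reverse (suc D + E) (c ⊠ g) ⊞ reverse (D + E) (tail f ⊠ g)
    ≈⟨ +-cong (reverse-pad E (suc D) (Deg≤-⊠ 0 E (Deg≤-const (f 0)) dg))
              (reverse-⊠ D E (λ k D<k → df (suc k) (s≤s D<k)) dg) ⟩
  X ^ suc D ⊠ reverse E (c ⊠ g) ⊞ reverse D (tail f) ⊠ reverse E g
    ≈⟨ ⊞-congʳ (reverse D (tail f) ⊠ reverse E g) (⊠-congˡ (X ^ suc D) (reverse-const-⊠ E (f 0) g)) ⟩
  X ^ suc D ⊠ (c ⊠ reverse E g) ⊞ reverse D (tail f) ⊠ reverse E g
    ≈⟨ solve 4 (λ x c r t → x :* (c :* r) :+ t :* r := (x :* c :+ t) :* r) ≈-refl
             (X ^ suc D) c (reverse E g) (reverse D (tail f)) ⟩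
  (X ^ suc D ⊠ c ⊞ reverse D (tail f)) ⊠ reverse E g
    ≈⟨ ⊠-congʳ (reverse E g) (≈-sym (reverse-suc D f)) ⟩
  reverse (suc D) f ⊠ reverse E g ∎
  where
  open ≈-Reasoning
  c = const (f 0)

reverse-^ : ∀ {f} r N → Deg≤ r f → reverse (N * r) (f ^ N) ≈ reverse r f ^ N
reverse-^ r zero df = reverse-zero 1ˢ
reverse-^ {f} r (suc N) df =
  ≈-trans (reverse-⊠ r (N * r) df (Deg≤-^ r N df)) (⊠-congˡ (reverse r f) (reverse-^ r N df))

-- Coefficient lists as series, and the series p_r

⟦_⟧ : Poly → Series
⟦ p ⟧ k = + coeff p k

coeff-⊕ : ∀ p q k → coeff (p ⊕ q) k ≡ coeff p k + coeff q k
coeff-⊕ [] q k = refl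
coeff-⊕ (a ∷ p) [] k = sym (ℕ.+-identityʳ _)
coeff-⊕ (a ∷ p) (b ∷ q) zero = refl
coeff-⊕ (a ∷ p) (b ∷ q) (suc k) = coeff-⊕ p q k

coeff-scale : ∀ a q k → coeff (scale a q) k ≡ a * coeff q k
coeff-scale a [] k = sym (ℕ.*-zeroʳ a)
coeff-scale a (b ∷ q) zero = refl
coeff-scale a (b ∷ q) (suc k) = coeff-scale a q k

⟦scale⊕⟧ : ∀ a q r k → ⟦ scale a q ⊕ r ⟧ k ≡ + a *ℤ ⟦ q ⟧ k +ℤ ⟦ r ⟧ k
⟦scale⊕⟧ a q r k = begin
  + coeff (scale a q ⊕ r) k              ≡⟨ cong +_ (coeff-⊕ (scale a q) r k) ⟩
  + (coeff (scale a q) k + coeff r k)     ≡⟨ ℤ.pos-+ (coeff (scale a q) k) (coeff r k) ⟩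
  + coeff (scale a q) k +ℤ ⟦ r ⟧ k        ≡⟨ cong (λ z → + z +ℤ ⟦ r ⟧ k) (coeff-scale a q k) ⟩
  + (a * coeff q k) +ℤ ⟦ r ⟧ k            ≡⟨ cong (_+ℤ ⟦ r ⟧ k) (ℤ.pos-* a (coeff q k)) ⟩
  + a *ℤ ⟦ q ⟧ k +ℤ ⟦ r ⟧ k              ∎
  where open ≡-Reasoning

⟦⊗⟧ : ∀ p q → ⟦ p ⊗ q ⟧ ≈ ⟦ p ⟧ ⊠ ⟦ q ⟧
⟦⊗⟧ p q = pointwise (go p)
  where
  go : ∀ p n → ⟦ p ⊗ q ⟧ n ≡ (⟦ p ⟧ ⊠ ⟦ q ⟧) n
  go [] n = sym (⊠-zeroˡ ⟦ q ⟧ n)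
  go (a ∷ p) zero = trans (⟦scale⊕⟧ a q (0 ∷ p ⊗ q) 0) (ℤ.+-identityʳ _)
  go (a ∷ p) (suc n) =
    trans (⟦scale⊕⟧ a q (0 ∷ p ⊗ q) (suc n)) (cong (+ a *ℤ ⟦ q ⟧ (suc n) +ℤ_) (go p n))

⟦^P⟧ : ∀ p N → ⟦ p ^P N ⟧ ≈ ⟦ p ⟧ ^ N
⟦^P⟧ p zero = pointwise λ { zero → refl ; (suc k) → refl }
⟦^P⟧ p (suc N) = ≈-trans (⟦⊗⟧ p (p ^P N)) (⊠-congˡ ⟦ p ⟧ (⟦^P⟧ p N))

P : ℕ → Series
P r = ⟦ pr r ⟧

binomP≡P^ : ∀ r N k → + binomP r N k ≡ (P r ^ N) k
binomP≡P^ r N = at (⟦^P⟧ (pr r) N)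

P-zero : P 0 ≈ 1ˢ
P-zero = pointwise λ { zero → refl ; (suc k) → refl }

P-suc : ∀ r → P (suc r) ≈ 1ˢ ⊞ X ⊠ P r
P-suc r = head-tail (P (suc r))

P-≤ : ∀ r k → k ≤ r → P r k ≡ 1ℤ
P-≤ r zero _ = refl
P-≤ (suc r) (suc k) (s≤s k≤r) = P-≤ r k k≤r

Deg≤-P : ∀ r → Deg≤ r (P r)
Deg≤-P zero (suc k) _ = refl
Deg≤-P (suc r) (suc k) (s≤s r<k) = Deg≤-P r k r<k

reverse-P : ∀ r → reverse r (P r) ≈ P r
reverse-P r = pointwise go
  where
  go : ∀ k → reverse r (P r) k ≡ P r k
  go k with k ≤? r
  ... | yes k≤r = trans (reverse-≤ r (P r) k k≤r)
                        (trans (P-≤ r (r ∸ k) (ℕ.m∸n≤m r k)) (sym (P-≤ r k k≤r)))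
  ... | no k≰r = trans (reverse-> r (P r) k (ℕ.≰⇒> k≰r)) (sym (Deg≤-P r k (ℕ.≰⇒> k≰r)))

P^-symmetric : ∀ r N k → k ≤ r * N → (P r ^ N) (r * N ∸ k) ≡ (P r ^ N) k
P^-symmetric r N k k≤rN = begin
  (P r ^ N) (r * N ∸ k)       ≡⟨ cong (λ D → (P r ^ N) (D ∸ k)) (ℕ.*-comm r N) ⟩
  (P r ^ N) (N * r ∸ k)       ≡⟨ sym (reverse-≤ (N * r) (P r ^ N) k (subst (k ≤_) (ℕ.*-comm r N) k≤rN)) ⟩
  reverse (N * r) (P r ^ N) k ≡⟨ at (reverse-^ r N (Deg≤-P r)) k ⟩
  (reverse r (P r) ^ N) k     ≡⟨ at (^-congˡ N (reverse-P r)) k ⟩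
  (P r ^ N) k                 ∎
  where open ≡-Reasoning

-- Parity

double : ℕ → ℕ
double zero = zero
double (suc k) = suc (suc (double k))

double≡*2 : ∀ k → double k ≡ k * 2
double≡*2 zero = refl
double≡*2 (suc k) = cong (suc ∘ suc) (double≡*2 k)

data Parity : ℕ → Set where
  even : ∀ j → Parity (double j)
  odd : ∀ j → Parity (suc (double j))

parity : ∀ k → Parity k
parity zero = even 0
parity (suc k) with parity k
... | even j = odd j
... | odd j = even (suc j)

double%2 : ∀ j → double j % 2 ≡ 0
double%2 j = trans (cong (_% 2) (double≡*2 j)) (m*n%n≡0 j 2)

suc-double%2 : ∀ j → suc (double j) % 2 ≡ 1
suc-double%2 j = trans (cong (λ d → suc d % 2) (double≡*2 j)) ([m+kn]%n≡m%n 1 j 2)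

double/2 : ∀ j → double j / 2 ≡ j
double/2 j = trans (cong (_/ 2) (double≡*2 j)) (m*n/n≡m j 2)

suc-+-suc≡double : ∀ s → suc (s + suc s) ≡ double (suc s)
suc-+-suc≡double s = cong suc (trans (ℕ.+-suc s s) (cong suc (go s)))
  where
  go : ∀ s → s + s ≡ double s
  go zero = refl
  go (suc s) = cong suc (trans (ℕ.+-suc s s) (cong suc (go s)))

*-even : ∀ m n → m % 2 ≡ 0 → (m * n) % 2 ≡ 0
*-even m n m%2≡0 = trans (%-distribˡ-* m n 2) (cong (λ r → (r * (n % 2)) % 2) m%2≡0)

dilate-double : ∀ f j → dilate f (double j) ≡ f j
dilate-double f zero = refl
dilate-double f (suc j) = dilate-double (tail f) j

dilate-suc-double : ∀ f j → dilate f (suc (double j)) ≡ 0ℤ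
dilate-suc-double f zero = refl
dilate-suc-double f (suc j) = dilate-suc-double (tail f) j

dilate-even : ∀ f k → k % 2 ≡ 0 → dilate f k ≡ f (k / 2)
dilate-even f k k%2≡0 with parity k
... | even j = trans (dilate-double f j) (cong f (sym (double/2 j)))
... | odd j = ⊥-elim (ℕ.1+n≢0 (trans (sym (suc-double%2 j)) k%2≡0))

dilate-odd : ∀ f k → k % 2 ≡ 1 → dilate f k ≡ 0ℤ
dilate-odd f k k%2≡1 with parity k
... | even j = ⊥-elim (ℕ.0≢1+n (trans (sym (double%2 j)) k%2≡1))
... | odd j = dilate-suc-double f j

-- p_r(t) p_r(−t)

P-add : ∀ a b → P (suc (a + b)) ≈ P a ⊞ X ^ suc a ⊠ P b
P-add zero b =
  ≈-trans (P-suc b) (+-cong (≈-sym P-zero) (⊠-congʳ (P b) (≈-sym (*-identityʳ X))))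
P-add (suc a) b = begin
  P (2 + a + b)                             ≈⟨ P-suc (suc (a + b)) ⟩
  1ˢ ⊞ X ⊠ P (suc (a + b))                  ≈⟨ ⊞-congˡ 1ˢ (⊠-congˡ X (P-add a b)) ⟩
  1ˢ ⊞ X ⊠ (P a ⊞ X ^ suc a ⊠ P b)
    ≈⟨ solve 4 (λ x p e q → con 1ℤ :+ x :* (p :+ e :* q) := (con 1ℤ :+ x :* p) :+ (x :* e) :* q)
             ≈-refl X (P a) (X ^ suc a) (P b) ⟩
  (1ˢ ⊞ X ⊠ P a) ⊞ X ^ (2 + a) ⊠ P b       ≈⟨ ⊞-congʳ (X ^ (2 + a) ⊠ P b) (≈-sym (P-suc a)) ⟩
  P (suc a) ⊞ X ^ (2 + a) ⊠ P b            ∎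
  where open ≈-Reasoning

P²-identity : ∀ s → P (suc s) ⊠ P (suc s) ⊞ ⊟ (X ⊠ (P s ⊠ P s)) ≈ P (double (suc s))
P²-identity s = begin
  P (suc s) ⊠ P (suc s) ⊞ ⊟ (X ⊠ (p ⊠ p))
    ≈⟨ ⊞-congʳ (⊟ (X ⊠ (p ⊠ p))) (*-cong P-split (P-suc s)) ⟩
  (p ⊞ e) ⊠ (1ˢ ⊞ X ⊠ p) ⊞ ⊟ (X ⊠ (p ⊠ p))
    ≈⟨ solve 3 (λ p e x → (p :+ e) :* (con 1ℤ :+ x :* p) :- x :* (p :* p)
                          := p :+ e :* (con 1ℤ :+ x :* p)) ≈-refl p e X ⟩
  p ⊞ e ⊠ (1ˢ ⊞ X ⊠ p)         ≈⟨ ⊞-congˡ p (⊠-congˡ e (≈-sym (P-suc s))) ⟩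
  p ⊞ e ⊠ P (suc s)             ≈⟨ ≈-sym (P-add s (suc s)) ⟩
  P (suc (s + suc s))           ≡⟨ cong P (suc-+-suc≡double s) ⟩
  P (double (suc s))            ∎
  where
  open ≈-Reasoning
  p = P s
  e = X ^ suc s
  P-split : P (suc s) ≈ p ⊞ e
  P-split = begin
    P (suc s)          ≡⟨ cong (P ∘ suc) (sym (ℕ.+-identityʳ s)) ⟩
    P (suc (s + 0))    ≈⟨ P-add s 0 ⟩
    p ⊞ e ⊠ P 0        ≈⟨ ⊞-congˡ p (≈-trans (⊠-congˡ e P-zero) (*-identityʳ e)) ⟩
    p ⊞ e              ∎

dilate-P-zero : dilate (P 0) ≈ 1ˢ
dilate-P-zero = ≈-trans (dilate-cong P-zero) dilate-1ˢ

dilate-P-suc : ∀ r → dilate (P (suc r)) ≈ 1ˢ ⊞ X ⊠ X ⊠ dilate (P r)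
dilate-P-suc r = begin
  dilate (P (suc r))                       ≈⟨ dilate-cong (P-suc r) ⟩
  dilate (1ˢ ⊞ X ⊠ P r)                    ≈⟨ dilate-⊞ 1ˢ (X ⊠ P r) ⟩
  dilate 1ˢ ⊞ dilate (X ⊠ P r)             ≈⟨ +-cong dilate-1ˢ (dilate-⊠ X (P r)) ⟩
  1ˢ ⊞ dilate X ⊠ dilate (P r)             ≈⟨ ⊞-congˡ 1ˢ (⊠-congʳ (dilate (P r)) dilate-X) ⟩
  1ˢ ⊞ X ⊠ X ⊠ dilate (P r)                ∎
  where open ≈-Reasoning

P-odd : ∀ s → P (suc (double s)) ≈ (1ˢ ⊞ X) ⊠ dilate (P s)
P-odd zero = begin
  P 1                        ≈⟨ P-suc 0 ⟩
  1ˢ ⊞ X ⊠ P 0               ≈⟨ ⊞-congˡ 1ˢ (≈-trans (⊠-congˡ X P-zero) (*-identityʳ X)) ⟩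
  1ˢ ⊞ X                     ≈⟨ ≈-sym (*-identityʳ (1ˢ ⊞ X)) ⟩
  (1ˢ ⊞ X) ⊠ 1ˢ              ≈⟨ ⊠-congˡ (1ˢ ⊞ X) (≈-sym dilate-P-zero) ⟩
  (1ˢ ⊞ X) ⊠ dilate (P 0)    ∎
  where open ≈-Reasoning
P-odd (suc s) = begin
  P (3 + double s)                              ≈⟨ P-suc (2 + double s) ⟩
  1ˢ ⊞ X ⊠ P (2 + double s)                     ≈⟨ ⊞-congˡ 1ˢ (⊠-congˡ X (P-suc (suc (double s)))) ⟩
  1ˢ ⊞ X ⊠ (1ˢ ⊞ X ⊠ P (suc (double s)))
    ≈⟨ ⊞-congˡ 1ˢ (⊠-congˡ X (⊞-congˡ 1ˢ (⊠-congˡ X (P-odd s)))) ⟩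
  1ˢ ⊞ X ⊠ (1ˢ ⊞ X ⊠ ((1ˢ ⊞ X) ⊠ d))
    ≈⟨ solve 2 (λ x d → con 1ℤ :+ x :* (con 1ℤ :+ x :* ((con 1ℤ :+ x) :* d))
                        := (con 1ℤ :+ x) :* (con 1ℤ :+ x :* x :* d)) ≈-refl X d ⟩
  (1ˢ ⊞ X) ⊠ (1ˢ ⊞ X ⊠ X ⊠ d)                   ≈⟨ ⊠-congˡ (1ˢ ⊞ X) (≈-sym (dilate-P-suc s)) ⟩
  (1ˢ ⊞ X) ⊠ dilate (P (suc s))                 ∎
  where
  open ≈-Reasoning
  d = dilate (P s)

P-even : ∀ s → P (double (suc s)) ≈ dilate (P (suc s)) ⊞ X ⊠ dilate (P s)
P-even s = begin
  P (double (suc s))                      ≈⟨ P-suc (suc (double s)) ⟩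
  1ˢ ⊞ X ⊠ P (suc (double s))             ≈⟨ ⊞-congˡ 1ˢ (⊠-congˡ X (P-odd s)) ⟩
  1ˢ ⊞ X ⊠ ((1ˢ ⊞ X) ⊠ d)
    ≈⟨ solve 2 (λ x d → con 1ℤ :+ x :* ((con 1ℤ :+ x) :* d) := (con 1ℤ :+ x :* x :* d) :+ x :* d)
             ≈-refl X d ⟩
  (1ˢ ⊞ X ⊠ X ⊠ d) ⊞ X ⊠ d               ≈⟨ ⊞-congʳ (X ⊠ d) (≈-sym (dilate-P-suc s)) ⟩
  dilate (P (suc s)) ⊞ X ⊠ d              ∎
  where
  open ≈-Reasoning
  d = dilate (P s)

twist-P-even : ∀ s → twist (P (double s)) ⊠ P (double s) ≈ dilate (P (double s))
twist-P-even zero = begin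
  twist (P 0) ⊠ P 0    ≈⟨ *-cong (≈-trans (twist-cong P-zero) twist-1ˢ) P-zero ⟩
  1ˢ ⊠ 1ˢ              ≈⟨ *-identityʳ 1ˢ ⟩
  1ˢ                   ≈⟨ ≈-sym dilate-P-zero ⟩
  dilate (P 0)         ∎
  where open ≈-Reasoning
twist-P-even (suc s) = begin
  twist (P m) ⊠ P m                        ≈⟨ *-cong twist-P-m (P-even s) ⟩
  (a ⊞ ⊟ X ⊠ b) ⊠ (a ⊞ X ⊠ b)
    ≈⟨ solve 3 (λ a x b → (a :+ :- x :* b) :* (a :+ x :* b) := a :* a :- (x :* x) :* (b :* b))
             ≈-refl a X b ⟩
  a ⊠ a ⊞ ⊟ (X ⊠ X ⊠ (b ⊠ b))
    ≈⟨ +-cong (≈-sym (dilate-⊠ q q))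
              (-‿cong (*-cong (≈-sym dilate-X) (≈-sym (dilate-⊠ p p)))) ⟩
  dilate (q ⊠ q) ⊞ ⊟ (dilate X ⊠ dilate (p ⊠ p))
    ≈⟨ ⊞-congˡ (dilate (q ⊠ q)) (-‿cong (≈-sym (dilate-⊠ X (p ⊠ p)))) ⟩
  dilate (q ⊠ q) ⊞ ⊟ dilate (X ⊠ (p ⊠ p))
    ≈⟨ ⊞-congˡ (dilate (q ⊠ q)) (≈-sym (dilate-⊟ (X ⊠ (p ⊠ p)))) ⟩
  dilate (q ⊠ q) ⊞ dilate (⊟ (X ⊠ (p ⊠ p)))
    ≈⟨ ≈-sym (dilate-⊞ (q ⊠ q) (⊟ (X ⊠ (p ⊠ p)))) ⟩
  dilate (q ⊠ q ⊞ ⊟ (X ⊠ (p ⊠ p)))          ≈⟨ dilate-cong (P²-identity s) ⟩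
  dilate (P m)                               ∎
  where
  open ≈-Reasoning
  m = double (suc s)
  p = P s
  q = P (suc s)
  a = dilate q
  b = dilate p
  twist-P-m : twist (P m) ≈ a ⊞ ⊟ X ⊠ b
  twist-P-m = begin
    twist (P m)                    ≈⟨ twist-cong (P-even s) ⟩
    twist (a ⊞ X ⊠ b)              ≈⟨ twist-⊞ a (X ⊠ b) ⟩
    twist a ⊞ twist (X ⊠ b)        ≈⟨ +-cong (twist-dilate q) (twist-⊠ X b) ⟩
    a ⊞ twist X ⊠ twist b          ≈⟨ ⊞-congˡ a (*-cong twist-X (twist-dilate p)) ⟩
    a ⊞ ⊟ X ⊠ b                    ∎

twist-1+X⊠1+X : twist (1ˢ ⊞ X) ⊠ (1ˢ ⊞ X) ≈ dilate (twist (1ˢ ⊞ X))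
twist-1+X⊠1+X = begin
  twist (1ˢ ⊞ X) ⊠ (1ˢ ⊞ X)     ≈⟨ ⊠-congʳ (1ˢ ⊞ X) twist-1+X ⟩
  (1ˢ ⊞ ⊟ X) ⊠ (1ˢ ⊞ X)
    ≈⟨ solve 1 (λ x → (con 1ℤ :- x) :* (con 1ℤ :+ x) := con 1ℤ :- x :* x) ≈-refl X ⟩
  1ˢ ⊞ ⊟ (X ⊠ X)                ≈⟨ ≈-sym (+-cong dilate-1ˢ (≈-trans (dilate-⊟ X) (-‿cong dilate-X))) ⟩
  dilate 1ˢ ⊞ dilate (⊟ X)      ≈⟨ ≈-sym (dilate-⊞ 1ˢ (⊟ X)) ⟩
  dilate (1ˢ ⊞ ⊟ X)             ≈⟨ dilate-cong (≈-sym twist-1+X) ⟩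
  dilate (twist (1ˢ ⊞ X))       ∎
  where
  open ≈-Reasoning
  twist-1+X : twist (1ˢ ⊞ X) ≈ 1ˢ ⊞ ⊟ X
  twist-1+X = ≈-trans (twist-⊞ 1ˢ X) (+-cong twist-1ˢ twist-X)

twist-P-odd : ∀ s →
  twist (P (suc (double s))) ⊠ P (suc (double s)) ≈ dilate (twist (1ˢ ⊞ X) ⊠ (P s ⊠ P s))
twist-P-odd s = begin
  twist (P m) ⊠ P m                 ≈⟨ *-cong twist-P-m (P-odd s) ⟩
  (twist u ⊠ d) ⊠ (u ⊠ d)
    ≈⟨ solve 3 (λ v u d → (v :* d) :* (u :* d) := (v :* u) :* (d :* d)) ≈-refl (twist u) u d ⟩
  (twist u ⊠ u) ⊠ (d ⊠ d)           ≈⟨ *-cong twist-1+X⊠1+X (≈-sym (dilate-⊠ (P s) (P s))) ⟩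
  dilate (twist u) ⊠ dilate (P s ⊠ P s) ≈⟨ ≈-sym (dilate-⊠ (twist u) (P s ⊠ P s)) ⟩
  dilate (twist u ⊠ (P s ⊠ P s))    ∎
  where
  open ≈-Reasoning
  m = suc (double s)
  u = 1ˢ ⊞ X
  d = dilate (P s)
  twist-P-m : twist (P m) ≈ twist u ⊠ d
  twist-P-m = ≈-trans (twist-cong (P-odd s))
                      (≈-trans (twist-⊠ u d) (⊠-congˡ (twist u) (twist-dilate (P s))))

-- Coefficients as finite sums

sumTo-cong : ∀ n {F G} → (∀ i → i ≤ n → F i ≡ G i) → sumTo n F ≡ sumTo n G
sumTo-cong zero F≡G = F≡G 0 z≤n
sumTo-cong (suc n) F≡G =
  cong₂ _+ℤ_ (sumTo-cong n λ i i≤n → F≡G i (ℕ.m≤n⇒m≤1+n i≤n)) (F≡G (suc n) ℕ.≤-refl)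

sumTo-head : ∀ n F → sumTo (suc n) F ≡ F 0 +ℤ sumTo n (F ∘ suc)
sumTo-head zero F = refl
sumTo-head (suc n) F = trans (cong (_+ℤ F (2 + n)) (sumTo-head n F)) (ℤ.+-assoc (F 0) _ _)

sumTo-vanishing : ∀ a b {F} → (∀ i → a < i → F i ≡ 0ℤ) → sumTo (b + a) F ≡ sumTo a F
sumTo-vanishing a zero F≡0 = refl
sumTo-vanishing a (suc b) F≡0 =
  trans (cong₂ _+ℤ_ (sumTo-vanishing a b F≡0) (F≡0 (suc (b + a)) (s≤s (ℕ.m≤n+m a b))))
        (ℤ.+-identityʳ _)

⊠-sumTo : ∀ f g n → (f ⊠ g) n ≡ sumTo n (λ i → f i *ℤ g (n ∸ i))
⊠-sumTo f g zero = refl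
⊠-sumTo f g (suc n) =
  trans (cong (f 0 *ℤ g (suc n) +ℤ_) (⊠-sumTo (tail f) g n))
        (sym (sumTo-head n (λ i → f i *ℤ g (suc n ∸ i))))

binomial : ∀ n i → ((1ˢ ⊞ X) ^ n) i ≡ + (n C i)
binomial zero zero = refl
binomial zero (suc i) = cong +_ (sym (k>n⇒nCk≡0 {0} {suc i} (s≤s z≤n)))
binomial (suc n) zero = trans (ℤ.*-identityˡ (((1ˢ ⊞ X) ^ n) 0)) (binomial n 0)
binomial (suc n) (suc i) = begin
  ((1ˢ ⊞ X) ⊠ h) (suc i)          ≡⟨ cong₂ _+ℤ_ (ℤ.*-identityˡ (h (suc i))) (⊠-congˡ-at h tail-1+X i) ⟩
  h (suc i) +ℤ (1ˢ ⊠ h) i         ≡⟨ cong₂ _+ℤ_ (binomial n (suc i)) (trans (1ˢ-⊠ h i) (binomial n i)) ⟩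
  + (n C suc i) +ℤ + (n C i)      ≡⟨ sym (ℤ.pos-+ (n C suc i) (n C i)) ⟩
  + (n C suc i + n C i)
    ≡⟨ cong +_ (trans (ℕ.+-comm (n C suc i) (n C i)) (nCk+nC[k+1]≡[n+1]C[k+1] n i)) ⟩
  + (suc n C suc i)               ∎
  where
  open ≡-Reasoning
  h = (1ˢ ⊞ X) ^ n
  tail-1+X : ∀ k → tail (1ˢ ⊞ X) k ≡ 1ˢ k
  tail-1+X zero = refl
  tail-1+X (suc k) = refl

binomPℤ-difference : ∀ r N h i → i ≤ h → binomPℤ r N (+ h -ℤ + i) ≡ binomP r N (h ∸ i)
binomPℤ-difference r N h i i≤h = cong (binomPℤ r N) (trans (ℤ.m-n≡m⊖n h i) (ℤ.⊖-≥ i≤h))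

binomPℤ-negative : ∀ r N h i → h < i → binomPℤ r N (+ h -ℤ + i) ≡ 0
binomPℤ-negative r N h (suc i) (s≤s h≤i) =
  cong (binomPℤ r N) (trans (ℤ.m-n≡m⊖n h (suc i))
                     (trans (ℤ.⊖-< (s≤s h≤i)) (cong (-_ ∘ +_) (ℕ.+-∸-assoc 1 h≤i))))

alternating-square-sum : ∀ m n →
  sumTo (m * n) (λ k → sgn k *ℤ (+ (binomP m n k * binomP m n k)))
    ≡ ((twist (P m) ⊠ P m) ^ n) (m * n)
alternating-square-sum m n = begin
  sumTo (m * n) (λ k → sgn k *ℤ (+ (binomP m n k * binomP m n k)))
    ≡⟨ sumTo-cong (m * n) term ⟩
  sumTo (m * n) (λ k → twist A k *ℤ A (m * n ∸ k))
    ≡⟨ sym (⊠-sumTo (twist A) A (m * n)) ⟩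
  (twist A ⊠ A) (m * n)
    ≡⟨ at (⊠-congʳ A (twist-^ (P m) n)) (m * n) ⟩
  (twist (P m) ^ n ⊠ A) (m * n)
    ≡⟨ at (≈-sym (^-distrib-* (twist (P m)) (P m) n)) (m * n) ⟩
  ((twist (P m) ⊠ P m) ^ n) (m * n) ∎
  where
  open ≡-Reasoning
  A = P m ^ n
  term : ∀ k → k ≤ m * n → sgn k *ℤ (+ (binomP m n k * binomP m n k)) ≡ twist A k *ℤ A (m * n ∸ k)
  term k k≤mn = begin
    sgn k *ℤ (+ (binomP m n k * binomP m n k))
      ≡⟨ cong (sgn k *ℤ_) (ℤ.pos-* (binomP m n k) (binomP m n k)) ⟩
    sgn k *ℤ (+ binomP m n k *ℤ + binomP m n k)     ≡⟨ sym (ℤ.*-assoc (sgn k) _ _) ⟩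
    sgn k *ℤ + binomP m n k *ℤ + binomP m n k
      ≡⟨ cong₂ (λ a b → sgn k *ℤ a *ℤ b) (binomP≡P^ m n k)
               (trans (binomP≡P^ m n k) (sym (P^-symmetric m n k k≤mn))) ⟩
    twist A k *ℤ A (m * n ∸ k)                     ∎

odd-coefficient : ∀ n s h →
  (twist ((1ˢ ⊞ X) ^ n) ⊠ P s ^ (2 * n)) h
    ≡ sumTo n (λ i → sgn i *ℤ (+ ((n C i) * binomPℤ s (2 * n) (+ h -ℤ + i))))
odd-coefficient n s h = begin
  (twist B ⊠ Q) h                            ≡⟨ ⊠-sumTo (twist B) Q h ⟩
  sumTo h (λ i → twist B i *ℤ Q (h ∸ i))     ≡⟨ sumTo-cong h term ⟩
  sumTo h G                                  ≡⟨ sym (sumTo-vanishing h n beyond-h) ⟩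
  sumTo (n + h) G                            ≡⟨ cong (λ N → sumTo N G) (ℕ.+-comm n h) ⟩
  sumTo (h + n) G                            ≡⟨ sumTo-vanishing n h beyond-n ⟩
  sumTo n G                                  ∎
  where
  open ≡-Reasoning
  B = (1ˢ ⊞ X) ^ n
  Q = P s ^ (2 * n)
  G : ℕ → ℤ
  G i = sgn i *ℤ (+ ((n C i) * binomPℤ s (2 * n) (+ h -ℤ + i)))
  term : ∀ i → i ≤ h → twist B i *ℤ Q (h ∸ i) ≡ G i
  term i i≤h = begin
    sgn i *ℤ B i *ℤ Q (h ∸ i)
      ≡⟨ cong₂ (λ a b → sgn i *ℤ a *ℤ b) (binomial n i) (sym (binomP≡P^ s (2 * n) (h ∸ i))) ⟩
    sgn i *ℤ + (n C i) *ℤ + binomP s (2 * n) (h ∸ i)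
      ≡⟨ ℤ.*-assoc (sgn i) _ _ ⟩
    sgn i *ℤ (+ (n C i) *ℤ + binomP s (2 * n) (h ∸ i))
      ≡⟨ cong (sgn i *ℤ_) (sym (ℤ.pos-* (n C i) _)) ⟩
    sgn i *ℤ + ((n C i) * binomP s (2 * n) (h ∸ i))
      ≡⟨ cong (λ b → sgn i *ℤ + ((n C i) * b)) (sym (binomPℤ-difference s (2 * n) h i i≤h)) ⟩
    G i ∎
  vanishing : ∀ i c → c ≡ 0 → sgn i *ℤ (+ c) ≡ 0ℤ
  vanishing i c refl = ℤ.*-zeroʳ (sgn i)
  beyond-h : ∀ i → h < i → G i ≡ 0ℤ
  beyond-h i h<i = vanishing i _ (trans (cong ((n C i) *_) (binomPℤ-negative s (2 * n) h i h<i))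
                                        (ℕ.*-zeroʳ (n C i)))
  beyond-n : ∀ i → n < i → G i ≡ 0ℤ
  beyond-n i n<i = vanishing i _ (cong (_* binomPℤ s (2 * n) (+ h -ℤ + i)) (k>n⇒nCk≡0 n<i))

alternatingSquareSum : ℕ → ℕ → ℤ
alternatingSquareSum m n = sumTo (m * n) (λ k → sgn k *ℤ (+ (binomP m n k * binomP m n k)))

even-case : ∀ s n →
  alternatingSquareSum (double s) n ≡ + binomP (double s) n ((double s * n) / 2)
even-case s n = begin
  alternatingSquareSum m n            ≡⟨ alternating-square-sum m n ⟩
  ((twist (P m) ⊠ P m) ^ n) (m * n)  ≡⟨ at (^-congˡ n (twist-P-even s)) (m * n) ⟩
  (dilate (P m) ^ n) (m * n)          ≡⟨ at (≈-sym (dilate-^ (P m) n)) (m * n) ⟩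
  dilate (P m ^ n) (m * n)            ≡⟨ dilate-even (P m ^ n) (m * n) (*-even m n (double%2 s)) ⟩
  (P m ^ n) ((m * n) / 2)             ≡⟨ sym (binomP≡P^ m n ((m * n) / 2)) ⟩
  + binomP m n ((m * n) / 2)          ∎
  where
  open ≡-Reasoning
  m = double s

odd-case : ∀ s n →
  alternatingSquareSum (suc (double s)) n
    ≡ dilate (twist ((1ˢ ⊞ X) ^ n) ⊠ P s ^ (2 * n)) (suc (double s) * n)
odd-case s n = trans (alternating-square-sum m n) (at power (m * n))
  where
  open ≈-Reasoning
  m = suc (double s)
  u = 1ˢ ⊞ X
  power : (twist (P m) ⊠ P m) ^ n ≈ dilate (twist (u ^ n) ⊠ P s ^ (2 * n))
  power = begin
    (twist (P m) ⊠ P m) ^ n                ≈⟨ ^-congˡ n (twist-P-odd s) ⟩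
    dilate (twist u ⊠ (P s ⊠ P s)) ^ n     ≈⟨ ≈-sym (dilate-^ (twist u ⊠ (P s ⊠ P s)) n) ⟩
    dilate ((twist u ⊠ (P s ⊠ P s)) ^ n)   ≈⟨ dilate-cong (^-distrib-* (twist u) (P s ⊠ P s) n) ⟩
    dilate (twist u ^ n ⊠ (P s ⊠ P s) ^ n)
      ≈⟨ dilate-cong (*-cong (≈-sym (twist-^ u n))
                             (≈-trans (^-congˡ n (⊠-congˡ (P s) (≈-sym (*-identityʳ (P s)))))
                                      (^-assocʳ (P s) 2 n))) ⟩
    dilate (twist (u ^ n) ⊠ P s ^ (2 * n)) ∎

mainTheorem11 : (m n : ℕ) → m ≥ 1 →
    ((m * n) % 2 ≡ 1 →
    sumTo (m * n) (λ k → sgn k *ℤ (+ (binomP m n k * binomP m n k))) ≡ + 0)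
    × (m % 2 ≡ 0 →
    sumTo (m * n) (λ k → sgn k *ℤ (+ (binomP m n k * binomP m n k)))
    ≡ + binomP m n ((m * n) / 2))
    × (m % 2 ≡ 1 → n % 2 ≡ 0 →
    sumTo (m * n) (λ k → sgn k *ℤ (+ (binomP m n k * binomP m n k)))
    ≡ sumTo n (λ i → sgn i *ℤ (+ ((n C i) * binomPℤ ((m ∸ 1) / 2) (2 * n) (+ ((m * n) / 2) -ℤ + i)))))
mainTheorem11 m n _ with parity m
... | even s =
      (λ mn%2≡1 → ⊥-elim (ℕ.0≢1+n (trans (sym (*-even (double s) n (double%2 s))) mn%2≡1)))
    , (λ _ → even-case s n)
    , (λ m%2≡1 _ → ⊥-elim (ℕ.0≢1+n (trans (sym (double%2 s)) m%2≡1)))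
... | odd s =
      (λ mn%2≡1 → trans (odd-case s n) (dilate-odd F (m′ * n) mn%2≡1))
    , (λ m%2≡0 → ⊥-elim (ℕ.0≢1+n (trans (sym m%2≡0) (suc-double%2 s))))
    , (λ _ n%2≡0 → begin
        alternatingSquareSum m′ n     ≡⟨ odd-case s n ⟩
        dilate F (m′ * n)             ≡⟨ dilate-even F (m′ * n) (mn-even n%2≡0) ⟩
        F ((m′ * n) / 2)              ≡⟨ odd-coefficient n s ((m′ * n) / 2) ⟩
        sumTo n (G s)                 ≡⟨ cong (sumTo n ∘ G) (sym (double/2 s)) ⟩
        sumTo n (G (double s / 2))    ∎)
  where
  open ≡-Reasoning
  m′ = suc (double s)
  F = twist ((1ˢ ⊞ X) ^ n) ⊠ P s ^ (2 * n)
  G : ℕ → ℕ → ℤ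
  G r i = sgn i *ℤ (+ ((n C i) * binomPℤ r (2 * n) (+ ((m′ * n) / 2) -ℤ + i)))
  mn-even : n % 2 ≡ 0 → (m′ * n) % 2 ≡ 0
  mn-even n%2≡0 = trans (cong (_% 2) (ℕ.*-comm m′ n)) (*-even n m′ n%2≡0)
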